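{- Let $S\subset\mathbb{F}_2^n$ and suppose there is a nonzero $\mathbf{s}\in\mathbb{F}_2^n$ with $\mathbf{s}+S=S$. Suppose $\#S$ is not a multiple of $4$, and let $r=\dim\langle\mathbf{s}_0+S\rangle$ for some (equivalently, any) $\mathbf{s}_0\in S$. Then $B(S)=\mathbb{F}_2^n\setminus H_{\mathbf{s}}$ and $b(S)=2^{r-1}$.
   Context: For $\mathbf{x},\mathbf{y}\in\mathbb{F}_2^n$ the pairing is $\mathbf{x}\cdot\mathbf{y}=\sum_{i=1}^n x_iy_i\in\mathbb{F}_2$, and $H_{\mathbf{y}}=\{\mathbf{x}\in\mathbb{F}_2^n\mid \mathbf{x}\cdot\mathbf{y}=0\}$. For a nonzero $\mathbf{y}$, a set $S$ is $\mathbf{y}$-balanced if $\#(S\cap H_{\mathbf{y}})=\#S/2$. $S$ is $\mathbf{y}$-constant if $S\subset H_{\mathbf{y}}$ or $S\cap H_{\mathbf{y}}=\emptyset$. The balancing set $B(S)$ is the set of nonzero $\mathbf{y}$ such that $S$ is $\mathbf{y}$-balanced; the constant set $C(S)$ is the set of $\mathbf{y}$ such that $S$ is $\mathbf{y}$-constant. The balancing number is $b(S)=\#B(S)/\#C(S)$. For $\mathbf{v}\in\mathbb{F}_2^n$, $\mathbf{v}+S=\{\mathbf{v}+\mathbf{x}\mid\mathbf{x}\in S\}$; $\langle\cdot\rangle$ denotes linear span. -}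

module Defs where

open import Data.Bool using (Bool; true; false; _xor_; _∧_; not)
open import Data.Nat using (ℕ; zero; suc; _+_; _*_; _∸_; _^_)
open import Data.Vec using (Vec; []; _∷_; zipWith; replicate; lookup)
open import Data.Fin using (Fin)
open import Data.List using (List; []; _∷_; map; filter; length; _++_; foldr)
open import Data.List.Relation.Unary.All using (All)
open import Data.Product using (Σ; ∃; _×_; _,_)
open import Relation.Binary.PropositionalEquality using (_≡_; _≢_)
open import Relation.Nullary using (¬_)
open import Relation.Unary using (Pred)
import Relation.Nullary.Decidable as Dec

-- Vectors of F₂ⁿ are Vec Bool n (true = 1), addition is xor.
V : ℕ → Set
V n = Vec Bool n

𝟎 : ∀ {n} → V n
𝟎 {n} = replicate n false

_⊕_ : ∀ {n} → V n → V n → V n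
_⊕_ = zipWith _xor_

dot : ∀ {n} → V n → V n → Bool
dot [] [] = false
dot (x ∷ xs) (y ∷ ys) = (x ∧ y) xor dot xs ys

inH : ∀ {n} → V n → V n → Bool
inH y x = not (dot x y)

allV : (n : ℕ) → List (V n)
allV zero = [] ∷ []
allV (suc n) = map (false ∷_) (allV n) ++ map (true ∷_) (allV n)

Subset : ℕ → Set
Subset n = V n → Bool

card : ∀ {n} → Subset n → ℕ
card {n} S = length (filter (λ x → Dec.T? (S x)) (allV n))
  where open import Data.Bool using (T)

_∩_ : ∀ {n} → Subset n → Subset n → Subset n
(S ∩ T) x = S x ∧ T x

_+ˢ_ : ∀ {n} → V n → Subset n → Subset n
(v +ˢ S) x = S (v ⊕ x)

-- S is y-balanced: #(S ∩ H_y) = #S / 2   (decided as 2·#(S ∩ H_y) = #S)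
balanced? : ∀ {n} → Subset n → V n → Bool
balanced? S y = Dec.does (2 * card (S ∩ inH y) Data.Nat.≟ card S)
  where import Data.Nat

allImp : ∀ {n} → Subset n → (V n → Bool) → Bool
allImp {n} S P = foldr (λ x acc → (not (S x) Data.Bool.∨ P x) ∧ acc) true (allV n)
  where import Data.Bool

constant? : ∀ {n} → Subset n → V n → Bool
constant? S y = allImp S (inH y) Data.Bool.∨ allImp S (λ x → not (inH y x))
  where import Data.Bool

isZero? : ∀ {n} → V n → Bool
isZero? [] = true
isZero? (x ∷ xs) = not x ∧ isZero? xs

B : ∀ {n} → Subset n → Subset n
B S y = not (isZero? y) ∧ balanced? S y

-- constant set C(S): all y with S y-constant (includes y = 0)
C : ∀ {n} → Subset n → Subset n
C S y = constant? S y

-- balancing number b(S) = #B(S) / #C(S)  is represented by the pair; see statement.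

sumL : ∀ {n} → List (V n) → V n
sumL = foldr _⊕_ 𝟎

InSpan : ∀ {n} → Subset n → V n → Set
InSpan {n} T x = Σ (List (V n)) λ L → All (λ v → T v ≡ true) L × sumL L ≡ x

lincomb : ∀ {n r} → Vec Bool r → Vec (V n) r → V n
lincomb [] [] = 𝟎
lincomb (true ∷ c) (b ∷ bs) = b ⊕ lincomb c bs
lincomb (false ∷ c) (b ∷ bs) = lincomb c bs

LinIndep : ∀ {n r} → Vec (V n) r → Set
LinIndep {n} {r} b = (c : Vec Bool r) → lincomb c b ≡ 𝟎 → c ≡ replicate r false

IsBasisOfSpan : ∀ {n r} → Subset n → Vec (V n) r → Set
IsBasisOfSpan {n} {r} T b =
  LinIndep b
  × ((i : Fin r) → InSpan T (lookup b i))
  × ((x : V n) → InSpan T x → Σ (Vec Bool r) λ c → lincomb c b ≡ x)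

DimSpan : ∀ {n} → Subset n → ℕ → Set
DimSpan {n} T r = Σ (Vec (V n) r) λ b → IsBasisOfSpan T b

-- If s · y = 1, translation by s exchanges S ∩ H_y and S ∖ H_y, so S is y-balanced.
-- If s · y = 0, then S ∩ H_y is itself s-invariant, hence of even size, and balance would
-- force 4 ∣ #S. Thus B(S) is the complement of H_s and has 2ⁿ⁻¹ elements. On the other
-- hand S is y-constant exactly when y annihilates s₀ + S, i.e. its span, a space of
-- dimension r ≥ 1 (it contains s), so C(S) is its annihilator, of size 2ⁿ⁻ʳ.
module Submission where

open import Defs
open import Algebra.Bundles using (CommutativeRing)
open import Data.Bool using (Bool; true; false; _xor_; _∧_; _∨_; not)
open import Data.Bool.Properties
  using ( xor-assoc; xor-comm; xor-same; xor-identityˡ; xor-identityʳ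
        ; ∧-comm; ∧-distribʳ-xor; ∧-zeroʳ; ∨-zeroʳ; not-injective; ⇔→≡; xor-∧-commutativeRing )
open import Data.List using (List; []; _∷_; map; filter; length; _++_; foldr)
open import Data.List.Membership.Propositional using (_∈_)
open import Data.List.Membership.Propositional.Properties using (∈-map⁺; ∈-++⁺ˡ; ∈-++⁺ʳ)
open import Data.List.Properties using (map-++; map-∘)
open import Data.List.Relation.Unary.All using (All; []; _∷_; universal)
import Data.List.Relation.Unary.All as All
open import Data.List.Relation.Unary.Any using (here)
open import Data.Nat using (ℕ; zero; suc; _+_; _*_; _∸_; _^_; NonZero; _≟_)
open import Data.Nat.Divisibility using (_∣_; divides; *-monoʳ-∣)
open import Data.Nat.ListAction using (sum)
open import Data.Nat.ListAction.Properties using (sum-++)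
open import Data.Nat.Properties
  using ( +-commutativeSemigroup; +-comm; +-identityʳ; +-cancelˡ-≡
        ; *-identityʳ; *-zeroʳ; *-comm; *-assoc; *-distribʳ-+; *-cancelˡ-≡ )
open import Data.Product using (∃; _×_; _,_)
import Data.Fin as Fin
open import Data.Vec using (Vec; []; _∷_; lookup)
import Data.Vec as Vec
open import Data.Vec.Relation.Binary.Pointwise.Inductive
  using (Pointwise-≡⇒≡; zipWith-assoc; zipWith-comm; zipWith-identityˡ; zipWith-identityʳ)
open import Function using (_∘_)
open import Function.Bundles using (_⇔_; mk⇔; Equivalence)
open import Function.Properties.Equivalence using () renaming (trans to ⇔-trans)
open import Relation.Binary.PropositionalEquality
open import Relation.Nullary using (¬_; contradiction)
import Relation.Nullary.Decidable as Dec

open import Algebra.Properties.CommutativeSemigroup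
  (CommutativeRing.+-commutativeSemigroup xor-∧-commutativeRing)
  using () renaming (interchange to xor-interchange)
open import Algebra.Properties.CommutativeSemigroup +-commutativeSemigroup
  using () renaming (interchange to +-interchange)

open Equivalence using (to; from)

⊕-assoc : ∀ {n} (x y z : V n) → (x ⊕ y) ⊕ z ≡ x ⊕ (y ⊕ z)
⊕-assoc x y z = Pointwise-≡⇒≡ (zipWith-assoc xor-assoc x y z)

⊕-comm : ∀ {n} (x y : V n) → x ⊕ y ≡ y ⊕ x
⊕-comm x y = Pointwise-≡⇒≡ (zipWith-comm xor-comm x y)

⊕-identityˡ : ∀ {n} (x : V n) → 𝟎 ⊕ x ≡ x
⊕-identityˡ x = Pointwise-≡⇒≡ (zipWith-identityˡ xor-identityˡ x)

⊕-identityʳ : ∀ {n} (x : V n) → x ⊕ 𝟎 ≡ x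
⊕-identityʳ x = Pointwise-≡⇒≡ (zipWith-identityʳ xor-identityʳ x)

⊕-self : ∀ {n} (x : V n) → x ⊕ x ≡ 𝟎
⊕-self []      = refl
⊕-self (a ∷ x) = cong₂ _∷_ (xor-same a) (⊕-self x)

⊕-cancelˡ : ∀ {n} (s x : V n) → s ⊕ (s ⊕ x) ≡ x
⊕-cancelˡ s x = begin
  s ⊕ (s ⊕ x)  ≡⟨ ⊕-assoc s s x ⟨
  (s ⊕ s) ⊕ x  ≡⟨ cong (_⊕ x) (⊕-self s) ⟩
  𝟎 ⊕ x        ≡⟨ ⊕-identityˡ x ⟩
  x            ∎
  where open ≡-Reasoning

dot-comm : ∀ {n} (x y : V n) → dot x y ≡ dot y x
dot-comm []      []      = refl
dot-comm (a ∷ x) (b ∷ y) = cong₂ _xor_ (∧-comm a b) (dot-comm x y)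

dot-distribˡ-⊕ : ∀ {n} (u v y : V n) → dot (u ⊕ v) y ≡ dot u y xor dot v y
dot-distribˡ-⊕ []      []      []      = refl
dot-distribˡ-⊕ (a ∷ u) (b ∷ v) (c ∷ y) = begin
  ((a xor b) ∧ c) xor dot (u ⊕ v) y
    ≡⟨ cong₂ _xor_ (∧-distribʳ-xor c a b) (dot-distribˡ-⊕ u v y) ⟩
  ((a ∧ c) xor (b ∧ c)) xor (dot u y xor dot v y)
    ≡⟨ xor-interchange (a ∧ c) (b ∧ c) (dot u y) (dot v y) ⟩
  ((a ∧ c) xor dot u y) xor ((b ∧ c) xor dot v y)
    ∎
  where open ≡-Reasoning

dot-distribʳ-⊕ : ∀ {n} (y u v : V n) → dot y (u ⊕ v) ≡ dot y u xor dot y v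
dot-distribʳ-⊕ y u v = begin
  dot y (u ⊕ v)            ≡⟨ dot-comm y (u ⊕ v) ⟩
  dot (u ⊕ v) y            ≡⟨ dot-distribˡ-⊕ u v y ⟩
  dot u y xor dot v y      ≡⟨ cong₂ _xor_ (dot-comm u y) (dot-comm v y) ⟩
  dot y u xor dot y v      ∎
  where open ≡-Reasoning

dot-zeroˡ : ∀ {n} (y : V n) → dot 𝟎 y ≡ false
dot-zeroˡ []      = refl
dot-zeroˡ (_ ∷ y) = dot-zeroˡ y

dot-zeroʳ : ∀ {n} (x : V n) → dot x 𝟎 ≡ false
dot-zeroʳ x = trans (dot-comm x 𝟎) (dot-zeroˡ x)

isZero?≡true⇔ : ∀ {n} (v : V n) → isZero? v ≡ true ⇔ v ≡ 𝟎
isZero?≡true⇔ _ = mk⇔ sound complete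
  where
  sound : ∀ {n} {v : V n} → isZero? v ≡ true → v ≡ 𝟎
  sound {v = []}        _ = refl
  sound {v = false ∷ v} e = cong (false ∷_) (sound e)

  complete : ∀ {n} {v : V n} → v ≡ 𝟎 → isZero? v ≡ true
  complete {zero}  refl = refl
  complete {suc n} refl = complete {n} refl

isZero?-≢𝟎 : ∀ {n} {v : V n} → v ≢ 𝟎 → isZero? v ≡ false
isZero?-≢𝟎 {v = v} v≢𝟎 with isZero? v in eq
... | true  = contradiction (to (isZero?≡true⇔ v) eq) v≢𝟎
... | false = refl

isZero?≡false⇒∃dot≡true : ∀ {n} (s : V n) → isZero? s ≡ false → ∃ λ u → dot u s ≡ true
isZero?≡false⇒∃dot≡true (true ∷ s)  _ = true ∷ 𝟎 , cong not (dot-zeroˡ s)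
isZero?≡false⇒∃dot≡true (false ∷ s) e with isZero?≡false⇒∃dot≡true s e
... | u , us = false ∷ u , us

lincomb-zero : ∀ {n r} (b : Vec (V n) r) → lincomb 𝟎 b ≡ 𝟎
lincomb-zero []      = refl
lincomb-zero (_ ∷ b) = lincomb-zero b

isZero?-lincomb : ∀ {n r} {b : Vec (V n) r} → LinIndep b →
                  (c : Vec Bool r) → isZero? (lincomb c b) ≡ isZero? c
isZero?-lincomb {b = b} indep c = ⇔→≡ (mk⇔ zero⇒zero zero⇐zero)
  where
  zero⇒zero : isZero? (lincomb c b) ≡ true → isZero? c ≡ true
  zero⇒zero e = from (isZero?≡true⇔ c) (indep c (to (isZero?≡true⇔ _) e))

  zero⇐zero : isZero? c ≡ true → isZero? (lincomb c b) ≡ true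
  zero⇐zero e = from (isZero?≡true⇔ _)
    (trans (cong (λ c → lincomb c b) (to (isZero?≡true⇔ c) e)) (lincomb-zero b))

pairings : ∀ {n r} → Vec (V n) r → V n → V r
pairings b y = Vec.map (dot y) b

dot-lincomb : ∀ {n r} (c : Vec Bool r) (b : Vec (V n) r) (y : V n) →
              dot y (lincomb c b) ≡ dot c (pairings b y)
dot-lincomb []          []      y = dot-zeroʳ y
dot-lincomb (false ∷ c) (_ ∷ b) y = dot-lincomb c b y
dot-lincomb (true ∷ c)  (v ∷ b) y =
  trans (dot-distribʳ-⊕ y v (lincomb c b)) (cong (dot y v xor_) (dot-lincomb c b y))

-- Sums over F₂ⁿ

𝟙 : Bool → ℕ
𝟙 true  = 1
𝟙 false = 0

∑ : (n : ℕ) → (V n → ℕ) → ℕ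
∑ zero    f = f []
∑ (suc n) f = ∑ n (f ∘ (false ∷_)) + ∑ n (f ∘ (true ∷_))

∑-cong : ∀ n {f g : V n → ℕ} → (∀ x → f x ≡ g x) → ∑ n f ≡ ∑ n g
∑-cong zero    f≗g = f≗g []
∑-cong (suc n) f≗g = cong₂ _+_ (∑-cong n (f≗g ∘ (false ∷_))) (∑-cong n (f≗g ∘ (true ∷_)))

∑-+ : ∀ n (f g : V n → ℕ) → ∑ n (λ x → f x + g x) ≡ ∑ n f + ∑ n g
∑-+ zero    f g = refl
∑-+ (suc n) f g =
  trans (cong₂ _+_ (∑-+ n (f ∘ (false ∷_)) (g ∘ (false ∷_))) (∑-+ n (f ∘ (true ∷_)) (g ∘ (true ∷_))))
        (+-interchange (∑ n (f ∘ (false ∷_))) _ _ _)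

∑-const : ∀ n k → ∑ n (λ _ → k) ≡ 2 ^ n * k
∑-const zero    k = sym (+-identityʳ k)
∑-const (suc n) k = begin
  ∑ n (λ _ → k) + ∑ n (λ _ → k)  ≡⟨ cong₂ _+_ (∑-const n k) (∑-const n k) ⟩
  2 ^ n * k + 2 ^ n * k          ≡⟨ *-distribʳ-+ k (2 ^ n) (2 ^ n) ⟨
  (2 ^ n + 2 ^ n) * k            ≡⟨ cong (λ m → (2 ^ n + m) * k) (+-identityʳ (2 ^ n)) ⟨
  2 ^ suc n * k                  ∎
  where open ≡-Reasoning

∑-*ʳ : ∀ n (f : V n → ℕ) k → ∑ n (λ x → f x * k) ≡ ∑ n f * k
∑-*ʳ zero    f k = refl
∑-*ʳ (suc n) f k =
  trans (cong₂ _+_ (∑-*ʳ n (f ∘ (false ∷_)) k) (∑-*ʳ n (f ∘ (true ∷_)) k))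
        (sym (*-distribʳ-+ k (∑ n (f ∘ (false ∷_))) _))

∑-*ˡ : ∀ n k (f : V n → ℕ) → ∑ n (λ x → k * f x) ≡ k * ∑ n f
∑-*ˡ n k f = begin
  ∑ n (λ x → k * f x)  ≡⟨ ∑-cong n (λ x → *-comm k (f x)) ⟩
  ∑ n (λ x → f x * k)  ≡⟨ ∑-*ʳ n f k ⟩
  ∑ n f * k            ≡⟨ *-comm (∑ n f) k ⟩
  k * ∑ n f            ∎
  where open ≡-Reasoning

∑-swap : ∀ m n (f : V m → V n → ℕ) → ∑ m (λ x → ∑ n (f x)) ≡ ∑ n (λ y → ∑ m (λ x → f x y))
∑-swap zero    n f = refl
∑-swap (suc m) n f =
  trans (cong₂ _+_ (∑-swap m n (f ∘ (false ∷_))) (∑-swap m n (f ∘ (true ∷_))))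
        (sym (∑-+ n (λ y → ∑ m (λ x → f (false ∷ x) y)) (λ y → ∑ m (λ x → f (true ∷ x) y))))

∑-translate : ∀ n (s : V n) (f : V n → ℕ) → ∑ n (λ x → f (s ⊕ x)) ≡ ∑ n f
∑-translate zero    []          f = refl
∑-translate (suc n) (false ∷ s) f =
  cong₂ _+_ (∑-translate n s (f ∘ (false ∷_))) (∑-translate n s (f ∘ (true ∷_)))
∑-translate (suc n) (true ∷ s)  f =
  trans (cong₂ _+_ (∑-translate n s (f ∘ (true ∷_))) (∑-translate n s (f ∘ (false ∷_))))
        (+-comm (∑ n (f ∘ (true ∷_))) _)

∑-𝟙-isZero? : ∀ n → ∑ n (𝟙 ∘ isZero?) ≡ 1
∑-𝟙-isZero? zero    = refl
∑-𝟙-isZero? (suc n) = cong₂ _+_ (∑-𝟙-isZero? n) (trans (∑-const n 0) (*-zeroʳ (2 ^ n)))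

length-filter≡sum-map : ∀ {A : Set} (P : A → Bool) (xs : List A) →
                        length (filter (Dec.T? ∘ P) xs) ≡ sum (map (𝟙 ∘ P) xs)
length-filter≡sum-map P []       = refl
length-filter≡sum-map P (x ∷ xs) with P x
... | true  = cong suc (length-filter≡sum-map P xs)
... | false = length-filter≡sum-map P xs

sum-map-allV : ∀ n (f : V n → ℕ) → sum (map f (allV n)) ≡ ∑ n f
sum-map-allV zero    f = +-identityʳ (f [])
sum-map-allV (suc n) f = begin
  sum (map f (map (false ∷_) vs ++ map (true ∷_) vs))
    ≡⟨ cong sum (map-++ f (map (false ∷_) vs) _) ⟩
  sum (map f (map (false ∷_) vs) ++ map f (map (true ∷_) vs))
    ≡⟨ sum-++ (map f (map (false ∷_) vs)) _ ⟩
  sum (map f (map (false ∷_) vs)) + sum (map f (map (true ∷_) vs))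
    ≡⟨ cong₂ (λ l l′ → sum l + sum l′) (map-∘ vs) (map-∘ vs) ⟨
  sum (map (f ∘ (false ∷_)) vs) + sum (map (f ∘ (true ∷_)) vs)
    ≡⟨ cong₂ _+_ (sum-map-allV n (f ∘ (false ∷_))) (sum-map-allV n (f ∘ (true ∷_))) ⟩
  ∑ (suc n) f
    ∎
  where
  open ≡-Reasoning
  vs = allV n

card≡∑ : ∀ {n} (S : Subset n) → card S ≡ ∑ n (𝟙 ∘ S)
card≡∑ {n} S = trans (length-filter≡sum-map S (allV n)) (sum-map-allV n (𝟙 ∘ S))

-- Counting by translations and hyperplanes

Invariant : ∀ {n} → V n → Subset n → Set
Invariant s S = ∀ x → (s +ˢ S) x ≡ S x

𝟙-split : ∀ t d → 𝟙 t ≡ 𝟙 (t ∧ not d) + 𝟙 (t ∧ d)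
𝟙-split true  true  = refl
𝟙-split true  false = refl
𝟙-split false _     = refl

-- x ↦ s ⊕ x maps T ∖ H_y bijectively onto T ∩ H_y.
∑-invariant-split : ∀ {n} {s y : V n} {T : Subset n} → Invariant s T → dot s y ≡ true →
                    ∑ n (λ x → 𝟙 (T x ∧ dot x y)) ≡ ∑ n (λ x → 𝟙 (T x ∧ not (dot x y)))
∑-invariant-split {n} {s} {y} {T} s+T≡T sy = begin
  ∑ n (λ x → 𝟙 (T x ∧ dot x y))
    ≡⟨ ∑-translate n s _ ⟨
  ∑ n (λ x → 𝟙 (T (s ⊕ x) ∧ dot (s ⊕ x) y))
    ≡⟨ ∑-cong n (λ x → cong₂ (λ t d → 𝟙 (t ∧ d)) (s+T≡T x) (dot-flip x)) ⟩
  ∑ n (λ x → 𝟙 (T x ∧ not (dot x y)))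
    ∎
  where
  open ≡-Reasoning
  dot-flip : ∀ x → dot (s ⊕ x) y ≡ not (dot x y)
  dot-flip x = trans (dot-distribˡ-⊕ s x y) (cong (_xor dot x y) sy)

∑-invariant-halves : ∀ {n} {s y : V n} {T : Subset n} → Invariant s T → dot s y ≡ true →
                     ∑ n (𝟙 ∘ T) ≡ 2 * ∑ n (λ x → 𝟙 (T x ∧ not (dot x y)))
∑-invariant-halves {n} {s} {y} {T} s+T≡T sy = begin
  ∑ n (𝟙 ∘ T)                                              ≡⟨ ∑-cong n (λ x → 𝟙-split (T x) (dot x y)) ⟩
  ∑ n (λ x → 𝟙 (T x ∧ not (dot x y)) + 𝟙 (T x ∧ dot x y))  ≡⟨ ∑-+ n _ _ ⟩
  A + ∑ n (λ x → 𝟙 (T x ∧ dot x y))                         ≡⟨ cong (A +_) (∑-invariant-split s+T≡T sy) ⟩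
  A + A                                                     ≡⟨ cong (A +_) (+-identityʳ A) ⟨
  2 * A                                                     ∎
  where
  open ≡-Reasoning
  A = ∑ n (λ x → 𝟙 (T x ∧ not (dot x y)))

card-invariant-halves : ∀ {n} {s y : V n} {S : Subset n} → Invariant s S → dot s y ≡ true →
                        card S ≡ 2 * card (S ∩ inH y)
card-invariant-halves {y = y} {S = S} s+S≡S sy = begin
  card S                     ≡⟨ card≡∑ S ⟩
  ∑ _ (𝟙 ∘ S)                ≡⟨ ∑-invariant-halves s+S≡S sy ⟩
  2 * ∑ _ (𝟙 ∘ (S ∩ inH y))  ≡⟨ cong (2 *_) (card≡∑ (S ∩ inH y)) ⟨
  2 * card (S ∩ inH y)       ∎
  where open ≡-Reasoning

∑-𝟙-inH-nonzero : ∀ n {u w : V n} → dot u w ≡ true → 2 * ∑ n (𝟙 ∘ inH w) ≡ 2 ^ n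
∑-𝟙-inH-nonzero n {u} {w} uw = begin
  2 * ∑ n (𝟙 ∘ inH w)  ≡⟨ ∑-invariant-halves {n} {u} {w} {λ _ → true} (λ _ → refl) uw ⟨
  ∑ n (λ _ → 1)        ≡⟨ ∑-const n 1 ⟩
  2 ^ n * 1            ≡⟨ *-identityʳ (2 ^ n) ⟩
  2 ^ n                ∎
  where open ≡-Reasoning

∑-𝟙-inH : ∀ n (w : V n) → 2 * ∑ n (𝟙 ∘ inH w) ≡ 2 ^ n + 𝟙 (isZero? w) * 2 ^ n
∑-𝟙-inH n w with isZero? w in w≟𝟎
... | false with isZero?≡false⇒∃dot≡true w w≟𝟎
...   | u , uw = trans (∑-𝟙-inH-nonzero n {u} uw) (sym (+-identityʳ (2 ^ n)))
∑-𝟙-inH n w | true = begin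
  2 * ∑ n (𝟙 ∘ inH w)  ≡⟨ cong (2 *_) (∑-cong n inH-𝟎) ⟩
  2 * ∑ n (λ _ → 1)    ≡⟨ cong (2 *_) (trans (∑-const n 1) (*-identityʳ (2 ^ n))) ⟩
  2 ^ n + 1 * 2 ^ n    ∎
  where
  open ≡-Reasoning
  inH-𝟎 : ∀ x → 𝟙 (inH w x) ≡ 1
  inH-𝟎 x rewrite to (isZero?≡true⇔ w) w≟𝟎 | dot-zeroʳ x = refl

∑-𝟙-∉H : ∀ n (s : V n) → s ≢ 𝟎 → 2 * ∑ n (λ y → 𝟙 (dot y s)) ≡ 2 ^ n
∑-𝟙-∉H n s s≢𝟎 with isZero?≡false⇒∃dot≡true s (isZero?-≢𝟎 s≢𝟎)
... | u , us = begin
  2 * ∑ n (λ y → 𝟙 (dot y s))  ≡⟨ cong (2 *_) (∑-invariant-split {n} {u} {s} {λ _ → true} (λ _ → refl) us) ⟩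
  2 * ∑ n (𝟙 ∘ inH s)          ≡⟨ ∑-𝟙-inH-nonzero n {u} us ⟩
  2 ^ n                        ∎
  where open ≡-Reasoning

∑-∑-𝟙-inH : ∀ k n (w : V k → V n) →
            2 * ∑ k (λ c → ∑ n (𝟙 ∘ inH (w c))) ≡ 2 ^ k * 2 ^ n + ∑ k (𝟙 ∘ isZero? ∘ w) * 2 ^ n
∑-∑-𝟙-inH k n w = begin
  2 * ∑ k (λ c → ∑ n (𝟙 ∘ inH (w c)))
    ≡⟨ ∑-*ˡ k 2 _ ⟨
  ∑ k (λ c → 2 * ∑ n (𝟙 ∘ inH (w c)))
    ≡⟨ ∑-cong k (λ c → ∑-𝟙-inH n (w c)) ⟩
  ∑ k (λ c → 2 ^ n + 𝟙 (isZero? (w c)) * 2 ^ n)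
    ≡⟨ ∑-+ k _ _ ⟩
  ∑ k (λ _ → 2 ^ n) + ∑ k (λ c → 𝟙 (isZero? (w c)) * 2 ^ n)
    ≡⟨ cong₂ _+_ (∑-const k (2 ^ n)) (∑-*ʳ k (𝟙 ∘ isZero? ∘ w) (2 ^ n)) ⟩
  2 ^ k * 2 ^ n + ∑ k (𝟙 ∘ isZero? ∘ w) * 2 ^ n
    ∎
  where open ≡-Reasoning

-- Both sides count twice the pairs (c, y) with y ∈ H_{Σ cᵢ bᵢ}, summed over y resp. over c.
annihilator-size : ∀ n r (b : Vec (V n) r) → LinIndep b →
                   ∑ n (𝟙 ∘ isZero? ∘ pairings b) * 2 ^ r ≡ 2 ^ n
annihilator-size n r b indep = +-cancelˡ-≡ (2 ^ n * 2 ^ r) _ _ (begin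
  2 ^ n * 2 ^ r + ∑ n (𝟙 ∘ isZero? ∘ pairings b) * 2 ^ r
    ≡⟨ ∑-∑-𝟙-inH n r (pairings b) ⟨
  2 * ∑ n (λ y → ∑ r (𝟙 ∘ inH (pairings b y)))
    ≡⟨ cong (2 *_) (∑-swap n r _) ⟩
  2 * ∑ r (λ c → ∑ n (λ y → 𝟙 (not (dot c (pairings b y)))))
    ≡⟨ cong (2 *_) (∑-cong r λ c → ∑-cong n λ y → cong (𝟙 ∘ not) (dot-lincomb c b y)) ⟨
  2 * ∑ r (λ c → ∑ n (𝟙 ∘ inH (lincomb c b)))
    ≡⟨ ∑-∑-𝟙-inH r n (λ c → lincomb c b) ⟩
  2 ^ r * 2 ^ n + ∑ r (λ c → 𝟙 (isZero? (lincomb c b))) * 2 ^ n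
    ≡⟨ cong₂ (λ p q → p + q * 2 ^ n) (*-comm (2 ^ r) (2 ^ n)) independent ⟩
  2 ^ n * 2 ^ r + 1 * 2 ^ n
    ≡⟨ cong (2 ^ n * 2 ^ r +_) (+-identityʳ (2 ^ n)) ⟩
  2 ^ n * 2 ^ r + 2 ^ n
    ∎)
  where
  open ≡-Reasoning
  independent : ∑ r (λ c → 𝟙 (isZero? (lincomb c b))) ≡ 1
  independent = trans (∑-cong r (cong 𝟙 ∘ isZero?-lincomb indep)) (∑-𝟙-isZero? r)

-- The constant set as an annihilator

Annihilates : ∀ {n} → V n → Subset n → Set
Annihilates y T = ∀ v → T v ≡ true → dot v y ≡ false

allV-complete : ∀ n (x : V n) → x ∈ allV n
allV-complete zero    []          = here refl
allV-complete (suc n) (false ∷ x) = ∈-++⁺ˡ (∈-map⁺ (false ∷_) (allV-complete n x))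
allV-complete (suc n) (true ∷ x)  =
  ∈-++⁺ʳ (map (false ∷_) (allV n)) (∈-map⁺ (true ∷_) (allV-complete n x))

foldr-∧≡true⇔All : ∀ {A : Set} (Q : A → Bool) (xs : List A) →
                   foldr (λ x acc → Q x ∧ acc) true xs ≡ true ⇔ All (λ x → Q x ≡ true) xs
foldr-∧≡true⇔All Q []       = mk⇔ (λ _ → []) (λ _ → refl)
foldr-∧≡true⇔All Q (x ∷ xs) with Q x in Qx
... | true  = mk⇔ (λ e → Qx ∷ to ih e) (λ { (_ ∷ all) → from ih all })
  where ih = foldr-∧≡true⇔All Q xs
... | false = mk⇔ (λ ()) (λ { (Qx′ ∷ _) → contradiction (trans (sym Qx) Qx′) λ () })

allImp≡true⇔ : ∀ {n} (S P : Subset n) → allImp S P ≡ true ⇔ (∀ x → S x ≡ true → P x ≡ true)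
allImp≡true⇔ {n} S P = mk⇔
  (λ e x Sx → to (implication⇔ (S x) (P x)) (All.lookup (to fold e) (allV-complete n x)) Sx)
  (λ h → from fold (universal (λ x → from (implication⇔ (S x) (P x)) (h x)) (allV n)))
  where
  fold = foldr-∧≡true⇔All (λ x → not (S x) ∨ P x) (allV n)

  implication⇔ : ∀ a b → not a ∨ b ≡ true ⇔ (a ≡ true → b ≡ true)
  implication⇔ true  b = mk⇔ (λ e _ → e) (λ f → f refl)
  implication⇔ false b = mk⇔ (λ _ ()) (λ _ → refl)

C≡true⇔pairing-constant : ∀ {n} (S : Subset n) (y : V n) →
                          C S y ≡ true ⇔ ∃ λ c → ∀ x → S x ≡ true → dot x y ≡ c
C≡true⇔pairing-constant S y = mk⇔ constant⇒ constant⇐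
  where
  inside  = allImp≡true⇔ S (inH y)
  outside = allImp≡true⇔ S (not ∘ inH y)

  constant⇒ : C S y ≡ true → ∃ λ c → ∀ x → S x ≡ true → dot x y ≡ c
  constant⇒ e with allImp S (inH y) in S⊆H
  ... | true  = false , λ x Sx → not-injective (to inside S⊆H x Sx)
  ... | false = true , λ x Sx → not-injective (not-injective (to outside e x Sx))

  constant⇐ : (∃ λ c → ∀ x → S x ≡ true → dot x y ≡ c) → C S y ≡ true
  constant⇐ (false , h) =
    cong (_∨ allImp S (not ∘ inH y)) (from inside λ x Sx → cong not (h x Sx))
  constant⇐ (true  , h) =
    trans (cong (allImp S (inH y) ∨_) (from outside λ x Sx → cong (not ∘ not) (h x Sx))) (∨-zeroʳ _)

dot-rebase : ∀ {n} (s₀ x y : V n) → dot x y ≡ dot s₀ y xor dot (s₀ ⊕ x) y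
dot-rebase s₀ x y =
  trans (cong (λ z → dot z y) (sym (⊕-cancelˡ s₀ x))) (dot-distribˡ-⊕ s₀ (s₀ ⊕ x) y)

C≡true⇔annihilates : ∀ {n} {S : Subset n} {s₀ : V n} → S s₀ ≡ true → (y : V n) →
                     C S y ≡ true ⇔ Annihilates y (s₀ +ˢ S)
C≡true⇔annihilates {S = S} {s₀} s₀∈S y = mk⇔
  (λ e v s₀+v∈S → let (c , dot≡c) = to (C≡true⇔pairing-constant S y) e in begin
    dot v y                      ≡⟨ dot-rebase s₀ v y ⟩
    dot s₀ y xor dot (s₀ ⊕ v) y  ≡⟨ cong₂ _xor_ (dot≡c s₀ s₀∈S) (dot≡c (s₀ ⊕ v) s₀+v∈S) ⟩
    c xor c                      ≡⟨ xor-same c ⟩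
    false                        ∎)
  (λ ann → from (C≡true⇔pairing-constant S y) (dot s₀ y , λ x x∈S → begin
    dot x y                      ≡⟨ dot-rebase s₀ x y ⟩
    dot s₀ y xor dot (s₀ ⊕ x) y  ≡⟨ cong (dot s₀ y xor_) (ann (s₀ ⊕ x) (trans (cong S (⊕-cancelˡ s₀ x)) x∈S)) ⟩
    dot s₀ y xor false           ≡⟨ xor-identityʳ (dot s₀ y) ⟩
    dot s₀ y                     ∎))
  where open ≡-Reasoning

InSpan-member : ∀ {n} {T : Subset n} {v : V n} → T v ≡ true → InSpan T v
InSpan-member {v = v} Tv = v ∷ [] , Tv ∷ [] , ⊕-identityʳ v

annihilates-span : ∀ {n} {T : Subset n} {y v : V n} → Annihilates y T → InSpan T v → dot v y ≡ false
annihilates-span {T = T} {y} ann (L , L⊆T , refl) = annihilates-sum L L⊆T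
  where
  annihilates-sum : ∀ L → All (λ v → T v ≡ true) L → dot (sumL L) y ≡ false
  annihilates-sum []      []          = dot-zeroˡ y
  annihilates-sum (v ∷ L) (Tv ∷ L⊆T) =
    trans (dot-distribˡ-⊕ v (sumL L) y) (cong₂ _xor_ (ann v Tv) (annihilates-sum L L⊆T))

annihilates⇔pairings≡𝟎 : ∀ {n r} {T : Subset n} {b : Vec (V n) r} → IsBasisOfSpan T b →
                         (y : V n) → Annihilates y T ⇔ isZero? (pairings b y) ≡ true
annihilates⇔pairings≡𝟎 {T = T} {b} (_ , b⊆⟨T⟩ , ⟨T⟩⊆⟨b⟩) y = mk⇔
  (λ ann → from (isZero?≡true⇔ _) (pairings≡𝟎 ann b b⊆⟨T⟩))
  (λ z v Tv → let (c , bc≡v) = ⟨T⟩⊆⟨b⟩ v (InSpan-member Tv) in begin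
    dot v y               ≡⟨ dot-comm v y ⟩
    dot y v               ≡⟨ cong (dot y) bc≡v ⟨
    dot y (lincomb c b)   ≡⟨ dot-lincomb c b y ⟩
    dot c (pairings b y)  ≡⟨ cong (dot c) (to (isZero?≡true⇔ _) z) ⟩
    dot c 𝟎               ≡⟨ dot-zeroʳ c ⟩
    false                 ∎)
  where
  open ≡-Reasoning
  pairings≡𝟎 : ∀ {r} → Annihilates y T → (b : Vec (V _) r) →
               (∀ i → InSpan T (lookup b i)) → pairings b y ≡ 𝟎
  pairings≡𝟎 ann []      _      = refl
  pairings≡𝟎 ann (v ∷ b) b⊆⟨T⟩ = cong₂ _∷_
    (trans (dot-comm y v) (annihilates-span ann (b⊆⟨T⟩ Fin.zero)))
    (pairings≡𝟎 ann b (b⊆⟨T⟩ ∘ Fin.suc))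

C≡annihilator : ∀ {n r} {S : Subset n} {s₀ : V n} {b : Vec (V n) r} → S s₀ ≡ true →
                IsBasisOfSpan (s₀ +ˢ S) b → (y : V n) → C S y ≡ isZero? (pairings b y)
C≡annihilator s₀∈S basis y =
  ⇔→≡ (⇔-trans (C≡true⇔annihilates s₀∈S y) (annihilates⇔pairings≡𝟎 basis y))

-- The balancing set of an invariant set

∩-inH-invariant : ∀ {n} {s y : V n} {S : Subset n} → Invariant s S → dot s y ≡ false →
                  Invariant s (S ∩ inH y)
∩-inH-invariant {s = s} {y} s+S≡S sy x =
  cong₂ (λ t d → t ∧ not d) (s+S≡S x) (trans (dot-distribˡ-⊕ s x y) (cong (_xor dot x y) sy))

card-invariant-even : ∀ {n} {s : V n} {S : Subset n} → s ≢ 𝟎 → Invariant s S → 2 ∣ card S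
card-invariant-even {s = s} {S} s≢𝟎 s+S≡S with isZero?≡false⇒∃dot≡true s (isZero?-≢𝟎 s≢𝟎)
... | u , us = divides (card (S ∩ inH u)) (begin
  card S                    ≡⟨ card-invariant-halves s+S≡S (trans (dot-comm s u) us) ⟩
  2 * card (S ∩ inH u)      ≡⟨ *-comm 2 (card (S ∩ inH u)) ⟩
  card (S ∩ inH u) * 2      ∎)
  where open ≡-Reasoning

balanced-if-∉H : ∀ {n} {s y : V n} {S : Subset n} → Invariant s S → dot s y ≡ true →
                 balanced? S y ≡ true
balanced-if-∉H {y = y} {S} s+S≡S sy =
  Dec.dec-true (2 * card (S ∩ inH y) ≟ card S) (sym (card-invariant-halves s+S≡S sy))

unbalanced-if-∈H : ∀ {n} {s y : V n} {S : Subset n} → s ≢ 𝟎 → Invariant s S → ¬ 4 ∣ card S →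
                   dot s y ≡ false → balanced? S y ≡ false
unbalanced-if-∈H {y = y} {S} s≢𝟎 s+S≡S 4∤∣S∣ sy = Dec.dec-false (2 * card (S ∩ inH y) ≟ card S)
  λ e → 4∤∣S∣ (subst (4 ∣_) e (*-monoʳ-∣ 2 (card-invariant-even s≢𝟎 (∩-inH-invariant s+S≡S sy))))

B≡∉H : ∀ {n} {s : V n} {S : Subset n} → s ≢ 𝟎 → Invariant s S → ¬ 4 ∣ card S →
       (y : V n) → B S y ≡ dot y s
B≡∉H {s = s} {S} s≢𝟎 s+S≡S 4∤∣S∣ y with dot y s in ys
... | true  = cong₂ (λ z β → not z ∧ β) (isZero?-≢𝟎 y≢𝟎) (balanced-if-∉H s+S≡S sy)
  where
  sy = trans (dot-comm s y) ys
  y≢𝟎 : y ≢ 𝟎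
  y≢𝟎 y≡𝟎 = contradiction (trans (sym ys) (trans (cong (λ z → dot z s) y≡𝟎) (dot-zeroˡ s))) λ ()
... | false = trans (cong (not (isZero? y) ∧_) (unbalanced-if-∈H s≢𝟎 s+S≡S 4∤∣S∣ sy)) (∧-zeroʳ _)
  where sy = trans (dot-comm s y) ys

card-B : ∀ {n} {s : V n} {S : Subset n} → s ≢ 𝟎 → Invariant s S → ¬ 4 ∣ card S →
         2 * card (B S) ≡ 2 ^ n
card-B {n} {s} {S} s≢𝟎 s+S≡S 4∤∣S∣ = begin
  2 * card (B S)               ≡⟨ cong (2 *_) (card≡∑ (B S)) ⟩
  2 * ∑ n (𝟙 ∘ B S)            ≡⟨ cong (2 *_) (∑-cong n (cong 𝟙 ∘ B≡∉H s≢𝟎 s+S≡S 4∤∣S∣)) ⟩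
  2 * ∑ n (λ y → 𝟙 (dot y s))  ≡⟨ ∑-𝟙-∉H n s s≢𝟎 ⟩
  2 ^ n                        ∎
  where open ≡-Reasoning

card-C : ∀ {n r} {S : Subset n} {s₀ : V n} {b : Vec (V n) r} → S s₀ ≡ true →
         IsBasisOfSpan (s₀ +ˢ S) b → card (C S) * 2 ^ r ≡ 2 ^ n
card-C {n} {r} {S} {b = b} s₀∈S basis@(indep , _) = begin
  card (C S) * 2 ^ r
    ≡⟨ cong (_* 2 ^ r) (card≡∑ (C S)) ⟩
  ∑ n (𝟙 ∘ C S) * 2 ^ r
    ≡⟨ cong (_* 2 ^ r) (∑-cong n (cong 𝟙 ∘ C≡annihilator s₀∈S basis)) ⟩
  ∑ n (𝟙 ∘ isZero? ∘ pairings b) * 2 ^ r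
    ≡⟨ annihilator-size n r b indep ⟩
  2 ^ n
    ∎
  where open ≡-Reasoning

basis-nonempty : ∀ {n r} {T : Subset n} {b : Vec (V n) r} {v : V n} →
                 IsBasisOfSpan T b → InSpan T v → v ≢ 𝟎 → NonZero r
basis-nonempty {r = suc _} _ _ _ = _
basis-nonempty {r = zero} {b = []} (_ , _ , ⟨T⟩⊆⟨b⟩) v∈⟨T⟩ v≢𝟎 with ⟨T⟩⊆⟨b⟩ _ v∈⟨T⟩
... | [] , 𝟎≡v = contradiction (sym 𝟎≡v) v≢𝟎

2*m≡n*2^r⇒m≡2^[r∸1]*n : ∀ r {m n} .{{_ : NonZero r}} → 2 * m ≡ n * 2 ^ r → m ≡ 2 ^ (r ∸ 1) * n
2*m≡n*2^r⇒m≡2^[r∸1]*n (suc r) {m} {n} e =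
  *-cancelˡ-≡ m (2 ^ r * n) 2 (trans e (trans (*-comm n (2 * 2 ^ r)) (*-assoc 2 (2 ^ r) n)))

proposition7 : (n : ℕ) (S : Subset n) (s : V n) →
    s ≢ 𝟎 →
    ((x : V n) → (s +ˢ S) x ≡ S x) →
    ¬ (4 ∣ card S) →
    (s₀ : V n) → S s₀ ≡ true →
    (r : ℕ) → DimSpan (s₀ +ˢ S) r →
    ((y : V n) → (B S y ≡ true ⇔ inH s y ≡ false))
    × (card (B S) ≡ 2 ^ (r ∸ 1) * card (C S))
proposition7 n S s s≢𝟎 s+S≡S 4∤∣S∣ s₀ s₀∈S r (b , basis) =
  B⇔∉H , 2*m≡n*2^r⇒m≡2^[r∸1]*n r (trans (card-B s≢𝟎 s+S≡S 4∤∣S∣) (sym (card-C s₀∈S basis)))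
  where
  B⇔∉H : (y : V n) → B S y ≡ true ⇔ inH s y ≡ false
  B⇔∉H y = mk⇔ (λ e → cong not (trans (sym (B≡∉H s≢𝟎 s+S≡S 4∤∣S∣ y)) e))
                (λ e → trans (B≡∉H s≢𝟎 s+S≡S 4∤∣S∣ y) (not-injective e))

  s∈⟨s₀+S⟩ : InSpan (s₀ +ˢ S) s
  s∈⟨s₀+S⟩ = InSpan-member (trans (cong S (⊕-comm s₀ s)) (trans (s+S≡S s₀) s₀∈S))

  instance
    r≢0 : NonZero r
    r≢0 = basis-nonempty basis s∈⟨s₀+S⟩ s≢𝟎
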